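{- Let $x,y$ be positive integers with $x\mid y$. Then $F(x,y)=1+\frac{y}{x}$.
   Context: For integers $a$ and $b>0$, $a \bmod b$ denotes the least nonnegative residue of $a$ modulo $b$. A Euclidean chain is a sequence $(x_i)_{i\ge1}$ with $x_1\in\mathbb{N}=\{1,2,\dots\}$, $x_2\in\mathbb{N}\cup\{0\}$, and for $i\ge2$: $x_{i+1}=(-x_{i-1})\bmod x_i$ if $x_i\notin\{0,1\}$, and $x_{i+1}=0$ otherwise. The Euclidean chain function $F:\mathbb{N}\times(\mathbb{N}\cup\{0\})\to\mathbb{N}$ is defined by $F(x_1,x_2)=$ the largest index $i$ such that $x_i\neq0$ in the Euclidean chain starting with $x_1,x_2$. -}

module Defs where

open import Data.Nat using (ℕ; zero; suc; _∸_; _%_; _<_; _≤_)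
open import Data.Product using (_×_; _,_)
open import Relation.Binary.PropositionalEquality using (_≡_; _≢_)

-- (-a) mod b for b ≥ 2 (here b = suc (suc k)): the least nonnegative residue of -a mod b
negMod : ℕ → ℕ → ℕ
negMod a zero = zero            -- never used (only called with b ∉ {0,1})
negMod a (suc zero) = zero
negMod a b@(suc (suc _)) = (b ∸ (a % b)) % b

-- One step of the Euclidean chain: given (x_{i-1}, x_i) produce (x_i, x_{i+1}).
step : ℕ × ℕ → ℕ × ℕ
step (p , zero) = (zero , zero)
step (p , suc zero) = (suc zero , zero)
step (p , b@(suc (suc _))) = (b , negMod p b)

-- pairAt x₁ x₂ n = (x_{n+1}, x_{n+2})
pairAt : ℕ → ℕ → ℕ → ℕ × ℕ
pairAt x₁ x₂ zero = (x₁ , x₂)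
pairAt x₁ x₂ (suc n) = step (pairAt x₁ x₂ n)

-- chain x₁ x₂ i = x_i  (1-indexed; index 0 is a dummy value, x₀ := 0 is irrelevant)
chain : ℕ → ℕ → ℕ → ℕ
chain x₁ x₂ zero = zero
chain x₁ x₂ (suc n) with pairAt x₁ x₂ n
... | (a , _) = a

IsF : ℕ → ℕ → ℕ → Set
IsF x₁ x₂ m = (1 ≤ m) × (chain x₁ x₂ m ≢ 0) × (∀ j → m < j → chain x₁ x₂ j ≡ 0)

-- Writing y = k x, the chain is x, k x, (k-1) x, ..., x, 0: whenever the previous term is
-- congruent to x modulo the current term j x, the next term is j x - x = (j-1) x. Hence the
-- last nonzero term is x_{k+1} = x, and F(x, y) = k + 1 = 1 + y / x.
module Submission where

open import Defs
open import Data.Nat using (ℕ; _+_; _/_; NonZero)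
open import Data.Nat.Divisibility using (_∣_)
open import Data.Nat.Base using (zero; suc; _*_; _∸_; _%_; _<_; _≤_; _≤′_; ≤′-refl; ≤′-step; z≤n; s≤s)
open import Data.Nat.Properties
  using (+-suc; +-comm; m≤m+n; m+n∸m≡n; n∸n≡0; ∸-monoʳ-<; m≤n⇒m<n∨m≡n; ≤⇒≤′; 1+n≢0)
open import Data.Nat.DivMod using (m<n⇒m%n≡m; n%n≡0; [m+n]%n≡m%n; m*n/n≡m)
open import Data.Nat.Divisibility using (divides)
open import Data.Product using (_,_)
open import Data.Sum using (inj₁; inj₂)
open import Relation.Binary.PropositionalEquality using (_≡_; refl; sym; trans; cong; subst; module ≡-Reasoning)

negMod-of-residue : ∀ {a b r} .{{_ : NonZero b}} → 0 < r → r ≤ b → a % b ≡ r % b → negMod a b ≡ b ∸ r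
negMod-of-residue {b = suc zero} {r = suc zero}     _ _         _ = refl
negMod-of-residue {b = suc zero} {r = suc (suc _)} _ (s≤s ()) _
negMod-of-residue {a} {b@(suc (suc _))} {r} 0<r r≤b a≡r with m≤n⇒m<n∨m≡n r≤b
... | inj₁ r<b = begin
  (b ∸ a % b) % b ≡⟨ cong (λ s → (b ∸ s) % b) (trans a≡r (m<n⇒m%n≡m r<b)) ⟩
  (b ∸ r) % b     ≡⟨ m<n⇒m%n≡m (∸-monoʳ-< 0<r r≤b) ⟩
  b ∸ r           ∎
  where open ≡-Reasoning
... | inj₂ refl = begin
  (b ∸ a % b) % b ≡⟨ cong (λ s → (b ∸ s) % b) (trans a≡r (n%n≡0 b)) ⟩
  b % b           ≡⟨ n%n≡0 b ⟩
  0               ≡⟨ sym (n∸n≡0 b) ⟩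
  b ∸ b           ∎
  where open ≡-Reasoning

step-nonzero : ∀ p b .{{_ : NonZero b}} → step (p , b) ≡ (b , negMod p b)
step-nonzero p (suc zero)    = refl
step-nonzero p (suc (suc _)) = refl

step-of-residue : ∀ {p r q} → p % (suc r + q) ≡ suc r % (suc r + q) → step (p , suc r + q) ≡ (suc r + q , q)
step-of-residue {p} {r} {q} p≡r = trans (step-nonzero p (suc r + q))
  (cong (suc r + q ,_) (trans (negMod-of-residue (s≤s z≤n) (m≤m+n (suc r) q) p≡r) (m+n∸m≡n (suc r) q)))

module _ (x-1 : ℕ) where
  private
    x : ℕ
    x = suc x-1

  pairAt-multiples : ∀ n r → pairAt x ((n + suc r) * x) (suc n) ≡ (suc r * x , r * x)
  pairAt-multiples zero    r = step-of-residue refl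
  pairAt-multiples (suc n) r = begin
    step (pairAt x ((suc n + suc r) * x) (suc n))
      ≡⟨ cong (λ k → step (pairAt x (k * x) (suc n))) (sym (+-suc n (suc r))) ⟩
    step (pairAt x ((n + suc (suc r)) * x) (suc n))
      ≡⟨ cong step (pairAt-multiples n (suc r)) ⟩
    step (suc (suc r) * x , suc r * x)
      ≡⟨ step-of-residue ([m+n]%n≡m%n x (suc r * x)) ⟩
    (suc r * x , r * x) ∎
    where open ≡-Reasoning

chain-suc : ∀ {a b n p q} → pairAt a b n ≡ (p , q) → chain a b (suc n) ≡ p
chain-suc {a} {b} {n} e with pairAt a b n
chain-suc refl | _ = refl

pairAt-null-onwards : ∀ {a b m n} → pairAt a b m ≡ (0 , 0) → m ≤′ n → pairAt a b n ≡ (0 , 0)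
pairAt-null-onwards e ≤′-refl      = e
pairAt-null-onwards e (≤′-step m≤n) = cong step (pairAt-null-onwards e m≤n)

isF-of-pairAt : ∀ {a b n p} → pairAt a b n ≡ (suc p , 0) → IsF a b (suc n)
isF-of-pairAt {a} {b} {n} e = s≤s z≤n , (λ x≡0 → 1+n≢0 (trans (sym (chain-suc {a} {b} {n} e)) x≡0)) , vanishes
  where
    vanishes : ∀ j → suc n < j → chain a b j ≡ 0
    vanishes (suc j) (s≤s n<j) = chain-suc {a} {b} {j} (pairAt-null-onwards (cong step e) (≤⇒≤′ n<j))

corollary4p15 : (x y : ℕ) → .{{_ : NonZero x}} → .{{_ : NonZero y}} → x ∣ y →
                IsF x y (1 + y / x)
corollary4p15 (suc _) _ {{_}} {{()}} (divides zero refl)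
corollary4p15 x@(suc x-1) _ (divides (suc k) refl) =
  subst (λ q → IsF x (suc k * x) (1 + q)) (sym (m*n/n≡m (suc k) x)) (isF-of-pairAt last-pair)
  where
    last-pair : pairAt x (suc k * x) (suc k) ≡ (1 * x , 0)
    last-pair = subst (λ m → pairAt x (m * x) (suc k) ≡ (1 * x , 0)) (+-comm k 1) (pairAt-multiples x-1 k 0)
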